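{- Let $i,m\in\mathbb{N}$ and let $A=(a_0,\dots,a_i)$ be a finite sequence of positive integers. Let $p_k/q_k=[a_0,\dots,a_k]$ ($0\le k\le i$) be the convergents of $A$ and $\tilde p_k/\tilde q_k$ ($0\le k\le i$) the convergents of the reversal $\widetilde A=(a_i,\dots,a_0)$. Then \[\begin{pmatrix} p_i & q_i\\ p_{i-1} & q_{i-1}\end{pmatrix}=\begin{pmatrix}\tilde p_i & \tilde p_{i-1}\\ \tilde q_i & \tilde q_{i-1}\end{pmatrix}.\] Furthermore, $A$ is an $m$-palindrome if and only if \[\begin{pmatrix} p_i & mq_i\\ p_{i-1} & q_{i-1}\end{pmatrix}=\begin{pmatrix}\tilde p_i & \tilde q_i\\ m\tilde p_{i-1} & \tilde q_{i-1}\end{pmatrix},\] and equivalently, $A$ is an $m$-palindrome if and only if $mq_i=p_{i-1}$.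
   Context: For a finite sequence $A=(a_0,\dots,a_i)$ of positive integers, $[A]=[a_0,\dots,a_i]$ is the value of the finite continued fraction. The convergents $p_k/q_k$ are determined by $\begin{pmatrix}p_k & p_{k-1}\\ q_k & q_{k-1}\end{pmatrix}=\begin{pmatrix}a_0&1\\1&0\end{pmatrix}\cdots\begin{pmatrix}a_k&1\\1&0\end{pmatrix}$ (so $p_k,q_k$ are coprime positive integers with $[a_0,\dots,a_k]=p_k/q_k$), and similarly for the reversal. $A$ is an $m$-palindrome if $[A]=m[\widetilde A]$, where $\widetilde A=(a_i,\dots,a_0)$. -}

module Defs where

open import Data.Nat using (ℕ; zero; suc; _+_; _*_)
open import Data.Integer using (+_)
open import Data.Rational using (ℚ; _/_; 0ℚ)
import Data.Rational as ℚ
open import Data.Vec using (Vec; []; _∷_; reverse)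

record Mat2 : Set where
  constructor mat
  field
    r11 r12 r21 r22 : ℕ
open Mat2 public

I₂ : Mat2
I₂ = mat 1 0 0 1

_⊗_ : Mat2 → Mat2 → Mat2
mat a b c d ⊗ mat e f g h =
  mat (a * e + b * g) (a * f + b * h) (c * e + d * g) (c * f + d * h)

M : ℕ → Mat2
M a = mat a 1 1 0

-- ( a_0 1 ; 1 0 ) ⋯ ( a_k 1 ; 1 0 )  =  ( p_k p_{k-1} ; q_k q_{k-1} )
cfMat : ∀ {n} → Vec ℕ n → Mat2
cfMat []       = I₂
cfMat (a ∷ as) = M a ⊗ cfMat as

-- last convergent data of a sequence A = (a_0,…,a_i):
-- p_i, p_{i-1}, q_i, q_{i-1}  (with p_{-1} = 1, q_{-1} = 0 when i = 0)
pL pL₋ qL qL₋ : ∀ {n} → Vec ℕ n → ℕ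
pL  A = r11 (cfMat A)
pL₋ A = r12 (cfMat A)
qL  A = r21 (cfMat A)
qL₋ A = r22 (cfMat A)

-- p / q as a rational (q = 0 never occurs for positive partial quotients;
-- the value 0 in that case is only a dummy)
frac : ℕ → ℕ → ℚ
frac p zero    = 0ℚ
frac p (suc q) = (+ p) / suc q

cfVal : ∀ {n} → Vec ℕ n → ℚ
cfVal A = frac (pL A) (qL A)

IsMPalindrome : ∀ {n} → ℕ → Vec ℕ n → Set
IsMPalindrome m A = cfVal A ≡ (+ m / 1) ℚ.* cfVal (reverse A)
  where open import Relation.Binary.PropositionalEquality using (_≡_)

{-# OPTIONS --safe #-}
-- Every factor ( a 1 ; 1 0 ) is symmetric, so the matrix of the reversed sequence is the
-- transpose of the matrix of A; this is the first identity.  Hence [Ã] = p_i / p_{i-1}, and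
-- p_i / q_i = m p_i / p_{i-1} amounts to m q_i = p_{i-1} after cancelling p_i > 0.
module Submission where

open import Defs
open import Data.Nat using (ℕ; suc; _*_; _<_)
open import Data.Vec using (Vec; lookup; reverse)
open import Data.Fin using (Fin)
open import Data.Product using (_×_)
open import Function.Bundles using (_⇔_)
open import Relation.Binary.PropositionalEquality using (_≡_)

open import Data.Nat using (_+_; z<s; >-nonZero)
open import Data.Nat.Properties using (*-mono-<; <-≤-trans; m≤m+n; *-cancelˡ-≡; *-comm; *-assoc; +-identityʳ; *-identityʳ; *-zeroʳ)
open import Data.Nat.Solver using (module +-*-Solver)
open import Data.Vec using ([]; _∷_; _∷ʳ_)
open import Data.Vec.Properties using (reverse-∷)
open import Data.Fin using (zero; suc)
open import Data.Product using (_,_)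
open import Function using (_∘_)
open import Function.Bundles using (mk⇔)
import Function.Properties.Equivalence as ⇔
open import Relation.Binary.PropositionalEquality using (refl; sym; trans; cong; cong₂; module ≡-Reasoning)
open import Data.Integer as ℤ using (+_)
open import Data.Integer.Properties using (pos-*)
open import Data.Rational as ℚ using (toℚᵘ; fromℚᵘ)
open import Data.Rational.Properties using (toℚᵘ-injective; toℚᵘ-fromℚᵘ; toℚᵘ-homo-*; fromℚᵘ-cong; normalize-injective-≃)
open import Data.Rational.Unnormalised as ℚᵘ using (ℚᵘ; mkℚᵘ; *≡*)
import Data.Rational.Unnormalised.Properties as ℚᵘ

transpose : Mat2 → Mat2
transpose X = mat (r11 X) (r21 X) (r12 X) (r22 X)

mat-cong : ∀ {a b c d a′ b′ c′ d′} →
           a ≡ a′ → b ≡ b′ → c ≡ c′ → d ≡ d′ → mat a b c d ≡ mat a′ b′ c′ d′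
mat-cong refl refl refl refl = refl

dot-assoc : ∀ a b e f g h i k →
            (a * e + b * g) * i + (a * f + b * h) * k ≡ a * (e * i + f * k) + b * (g * i + h * k)
dot-assoc = solve 8 (λ a b e f g h i k →
  (a :* e :+ b :* g) :* i :+ (a :* f :+ b :* h) :* k := a :* (e :* i :+ f :* k) :+ b :* (g :* i :+ h :* k)) refl
  where open +-*-Solver

⊗-assoc : ∀ X Y Z → (X ⊗ Y) ⊗ Z ≡ X ⊗ (Y ⊗ Z)
⊗-assoc (mat a b c d) (mat e f g h) (mat i j k l) =
  mat-cong (dot-assoc a b e f g h i k) (dot-assoc a b e f g h j l)
           (dot-assoc c d e f g h i k) (dot-assoc c d e f g h j l)

⊗-identityˡ : ∀ X → I₂ ⊗ X ≡ X
⊗-identityˡ (mat a b c d) = mat-cong (upper a c) (upper b d) (lower a c) (lower b d)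
  where
  upper : ∀ x y → 1 * x + 0 * y ≡ x
  upper x y = trans (+-identityʳ (x + 0)) (+-identityʳ x)
  lower : ∀ x y → 0 * x + 1 * y ≡ y
  lower x y = +-identityʳ y

⊗-identityʳ : ∀ X → X ⊗ I₂ ≡ X
⊗-identityʳ (mat a b c d) = mat-cong (left a b) (right a b) (left c d) (right c d)
  where
  left : ∀ x y → x * 1 + y * 0 ≡ x
  left x y = trans (cong₂ _+_ (*-identityʳ x) (*-zeroʳ y)) (+-identityʳ x)
  right : ∀ x y → x * 0 + y * 1 ≡ y
  right x y = cong₂ _+_ (*-zeroʳ x) (*-identityʳ y)

transpose-⊗ : ∀ X Y → transpose (X ⊗ Y) ≡ transpose Y ⊗ transpose X
transpose-⊗ (mat a b c d) (mat e f g h) =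
  mat-cong (dot-comm a b e g) (dot-comm c d e g) (dot-comm a b f h) (dot-comm c d f h)
  where
  dot-comm : ∀ x y u v → x * u + y * v ≡ u * x + v * y
  dot-comm x y u v = cong₂ _+_ (*-comm x u) (*-comm y v)

cfMat-∷ʳ : ∀ {n} (as : Vec ℕ n) a → cfMat (as ∷ʳ a) ≡ cfMat as ⊗ M a
cfMat-∷ʳ []       a = trans (⊗-identityʳ (M a)) (sym (⊗-identityˡ (M a)))
cfMat-∷ʳ (b ∷ as) a = trans (cong (M b ⊗_) (cfMat-∷ʳ as a)) (sym (⊗-assoc (M b) (cfMat as) (M a)))

cfMat-reverse : ∀ {n} (as : Vec ℕ n) → cfMat (reverse as) ≡ transpose (cfMat as)
cfMat-reverse []       = refl
cfMat-reverse (a ∷ as) = begin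
  cfMat (reverse (a ∷ as))             ≡⟨ cong cfMat (reverse-∷ a as) ⟩
  cfMat (reverse as ∷ʳ a)              ≡⟨ cfMat-∷ʳ (reverse as) a ⟩
  cfMat (reverse as) ⊗ M a             ≡⟨ cong (_⊗ M a) (cfMat-reverse as) ⟩
  transpose (cfMat as) ⊗ transpose (M a) ≡⟨ sym (transpose-⊗ (M a) (cfMat as)) ⟩
  transpose (M a ⊗ cfMat as)           ∎
  where open ≡-Reasoning

reverse-convergents : ∀ {n} (A : Vec ℕ n) →
  (pL A ≡ pL (reverse A)) × (qL A ≡ pL₋ (reverse A)) × (pL₋ A ≡ qL (reverse A)) × (qL₋ A ≡ qL₋ (reverse A))
reverse-convergents A rewrite cfMat-reverse A = refl , refl , refl , refl

-- q_{i-1} is left out: it is 0 when i = 0.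
record Positive (X : Mat2) : Set where
  field
    p>0  : 0 < r11 X
    p₋>0 : 0 < r12 X
    q>0  : 0 < r21 X

0<*+ : ∀ {x y} z → 0 < x → 0 < y → 0 < x * y + z
0<*+ z x>0 y>0 = <-≤-trans (*-mono-< x>0 y>0) (m≤m+n _ z)

M-⊗-positive : ∀ {a X} → 0 < a → Positive X → Positive (M a ⊗ X)
M-⊗-positive a>0 X>0 = record
  { p>0  = 0<*+ _ a>0 p>0
  ; p₋>0 = 0<*+ _ a>0 p₋>0
  ; q>0  = 0<*+ {1} _ z<s p>0
  }
  where open Positive X>0

cfMat-positive : ∀ {n} (A : Vec ℕ (suc n)) → (∀ k → 0 < lookup A k) → Positive (cfMat A)
cfMat-positive (a ∷ [])     A>0 rewrite ⊗-identityʳ (M a) = record { p>0 = A>0 zero ; p₋>0 = z<s ; q>0 = z<s }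
cfMat-positive (a ∷ b ∷ as) A>0 = M-⊗-positive (A>0 zero) (cfMat-positive (b ∷ as) (A>0 ∘ suc))

frac-≡⇔ : ∀ a c {b d} → 0 < b → 0 < d → (frac a b ≡ frac c d) ⇔ (a * d ≡ c * b)
frac-≡⇔ a c {suc b} {suc d} _ _ = mk⇔ (normalize-injective-≃ a c (suc b) (suc d)) λ e →
  fromℚᵘ-cong {mkℚᵘ (+ a) b} {mkℚᵘ (+ c) d} (*≡* (cast e))
  where
  cast : a * suc d ≡ c * suc b → + a ℤ.* + suc d ≡ + c ℤ.* + suc b
  cast e = trans (sym (pos-* a (suc d))) (trans (cong +_ e) (pos-* c (suc b)))

*-frac : ∀ m p {q} → 0 < q → (+ m ℚ./ 1) ℚ.* frac p q ≡ frac (m * p) q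
*-frac m p {suc q} _ = toℚᵘ-injective (begin
  toℚᵘ (fromℚᵘ v ℚ.* fromℚᵘ u)         ≈⟨ toℚᵘ-homo-* (fromℚᵘ v) (fromℚᵘ u) ⟩
  toℚᵘ (fromℚᵘ v) ℚᵘ.* toℚᵘ (fromℚᵘ u)  ≈⟨ ℚᵘ.*-cong (toℚᵘ-fromℚᵘ v) (toℚᵘ-fromℚᵘ u) ⟩
  v ℚᵘ.* u                             ≈⟨ *≡* (cong₂ ℤ._*_ (sym (pos-* m p)) (cong (+_ ∘ suc) (sym (+-identityʳ q)))) ⟩
  mkℚᵘ (+ (m * p)) q                   ≈⟨ toℚᵘ-fromℚᵘ (mkℚᵘ (+ (m * p)) q) ⟨
  toℚᵘ (frac (m * p) (suc q))          ∎)
  where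
  open ℚᵘ.≃-Reasoning
  v u : ℚᵘ
  v = mkℚᵘ (+ m) 0
  u = mkℚᵘ (+ p) q

frac-≡-*-frac⇔ : ∀ m {p q p₋} → 0 < p → 0 < q → 0 < p₋ →
                 (frac p q ≡ (+ m ℚ./ 1) ℚ.* frac p p₋) ⇔ (m * q ≡ p₋)
frac-≡-*-frac⇔ m {p} {q} {p₋} p>0 q>0 p₋>0 rewrite *-frac m p p₋>0 =
  ⇔.trans (frac-≡⇔ p (m * p) q>0 p₋>0) (mk⇔ cancel (λ e → trans (cong (p *_) (sym e)) (sym regroup)))
  where
  regroup : m * p * q ≡ p * (m * q)
  regroup = trans (cong (_* q) (*-comm m p)) (*-assoc p m q)
  cancel : p * p₋ ≡ m * p * q → m * q ≡ p₋
  cancel e = sym (*-cancelˡ-≡ p₋ (m * q) p {{>-nonZero p>0}} (trans e regroup))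

IsMPalindrome⇔ : ∀ {n} m (A : Vec ℕ (suc n)) → (∀ k → 0 < lookup A k) →
                 IsMPalindrome m A ⇔ (m * qL A ≡ pL₋ A)
IsMPalindrome⇔ m A A>0 rewrite cfMat-reverse A = frac-≡-*-frac⇔ m p>0 q>0 p₋>0
  where open Positive (cfMat-positive A A>0)

m-palindrome-matrices⇔ : ∀ {n} m (A : Vec ℕ n) →
  (m * qL A ≡ pL₋ A) ⇔
  ((pL A ≡ pL (reverse A)) × (m * qL A ≡ qL (reverse A)) × (pL₋ A ≡ m * pL₋ (reverse A)) × (qL₋ A ≡ qL₋ (reverse A)))
m-palindrome-matrices⇔ m A rewrite cfMat-reverse A = mk⇔ (λ e → refl , e , sym e , refl) (λ (_ , e , _ , _) → e)

lemma3p2 : (i m : ℕ) (A : Vec ℕ (suc i)) → (∀ k → 0 < lookup A k) →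
    ((pL A ≡ pL (reverse A)) × (qL A ≡ pL₋ (reverse A))
      × (pL₋ A ≡ qL (reverse A)) × (qL₋ A ≡ qL₋ (reverse A)))
    × (IsMPalindrome m A ⇔
        ((pL A ≡ pL (reverse A)) × (m * qL A ≡ qL (reverse A))
          × (pL₋ A ≡ m * pL₋ (reverse A)) × (qL₋ A ≡ qL₋ (reverse A))))
    × (IsMPalindrome m A ⇔ (m * qL A ≡ pL₋ A))
lemma3p2 i m A A>0 =
  reverse-convergents A , ⇔.trans palindrome (m-palindrome-matrices⇔ m A) , palindrome
  where
  palindrome : IsMPalindrome m A ⇔ (m * qL A ≡ pL₋ A)
  palindrome = IsMPalindrome⇔ m A A>0
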